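{- If $(G,T)$ is a bad grid instance, then $G$ does not admit an acyclic $T$-odd orientation.
   Context: Graphs are finite and simple. An orientation is $T$-odd if every vertex $v$ has odd in-degree iff $v\in T$; acyclic means no directed cycle. $G=P_p\square P_q$ where $P_p$ is the path $u_0\cdots u_{p-1}$ and $P_q$ the path $v_0\cdots v_{q-1}$; vertices are $(u_i,v_j)$, adjacent iff equal in one coordinate and adjacent in the other path. $X_j=\{(u_i,v_j):0\le i\le p-1\}$ induces a path ordered by $i$; $Y_i=\{(u_i,v_j):0\le j\le q-1\}$ induces a path ordered by $j$. A bad path instance is $(H,T')$ with $H$ a path $w_0\cdots w_{h-1}$, $h$ even, $w_0,w_{h-1}\in T'$, and for each $k\in\{1,\dots,(h-2)/2\}$, $w_{2k-1}\in T'$ iff $w_{2k}\in T'$. $(G,T)$ (with $T\subseteq V(G)$) is a bad grid instance if $p,q$ are both even, $(G[U],T\cap U)$ is a bad path instance for each $U\in\{X_0,X_{q-1},Y_0,Y_{p-1}\}$, and $(u_i,v_j)\in T$ for all $1\le i\le p-2$, $1\le j\le q-2$. -}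

module Defs where

open import Data.Nat using (ℕ; zero; suc; _+_; _*_; _∸_; _≤_; _<_)
open import Data.Nat.Divisibility using (_∣_)
open import Data.Nat.DivMod using (_%_)
open import Data.Fin using (Fin; toℕ)
open import Data.Product using (_×_; _,_)
open import Data.Sum using (_⊎_)
open import Data.Bool using (Bool; true; false; if_then_else_)
open import Data.List using (List; map; allFin)
open import Data.Nat.ListAction using (sum)
open import Relation.Binary.PropositionalEquality using (_≡_)
open import Relation.Nullary using (¬_)
open import Relation.Binary.Construct.Closure.Transitive using (TransClosure)
open import Function.Bundles using (_⇔_)

-- Vertices of the grid P_p □ P_q : (u_i , v_j) is represented by (i , j).
Vertex : ℕ → ℕ → Set
Vertex p q = Fin p × Fin q

PathAdj : {n : ℕ} → Fin n → Fin n → Set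
PathAdj a b = (suc (toℕ a) ≡ toℕ b) ⊎ (suc (toℕ b) ≡ toℕ a)

GridAdj : {p q : ℕ} → Vertex p q → Vertex p q → Set
GridAdj (i , j) (i' , j') = (i ≡ i' × PathAdj j j') ⊎ (j ≡ j' × PathAdj i i')

-- An orientation of the grid: dir u v = true means the edge uv is directed u → v.
-- Arcs only along edges, and every edge receives exactly one direction.
record Orientation (p q : ℕ) : Set where
  field
    dir      : Vertex p q → Vertex p q → Bool
    dir-edge : ∀ u v → dir u v ≡ true → GridAdj u v
    one-way  : ∀ u v → GridAdj u v → dir u v ≡ true → dir v u ≡ false
    some-way : ∀ u v → GridAdj u v → dir u v ≡ false → dir v u ≡ true
open Orientation public

Arc : {p q : ℕ} → Orientation p q → Vertex p q → Vertex p q → Set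
Arc o u v = dir o u v ≡ true

indeg : {p q : ℕ} → Orientation p q → Vertex p q → ℕ
indeg {p} {q} o v =
  sum (map (λ i → sum (map (λ j → if dir o (i , j) v then 1 else 0) (allFin q))) (allFin p))

TOdd : {p q : ℕ} → (Vertex p q → Bool) → Orientation p q → Set
TOdd T o = ∀ v → (indeg o v % 2 ≡ 1) ⇔ (T v ≡ true)

Acyclic : {p q : ℕ} → Orientation p q → Set
Acyclic o = ∀ v → ¬ TransClosure (Arc o) v v

-- bad path instance on the path w_0 … w_{h-1}, with T' given by t (t k = true iff w_k ∈ T')
BadPath : (h : ℕ) → (Fin h → Bool) → Set
BadPath h t =
  (2 ∣ h) × (0 < h)
  × (∀ (a : Fin h) → toℕ a ≡ 0 → t a ≡ true)
  × (∀ (a : Fin h) → toℕ a ≡ h ∸ 1 → t a ≡ true)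
  × (∀ (k : ℕ) (a b : Fin h) → 1 ≤ k → 2 * k ≤ h ∸ 2 →
       toℕ a ≡ 2 * k ∸ 1 → toℕ b ≡ 2 * k → (t a ≡ true ⇔ t b ≡ true))

BadGrid : (p q : ℕ) → (Vertex p q → Bool) → Set
BadGrid p q T =
  (2 ∣ p) × (2 ∣ q)
  -- X_0 and X_{q-1} : rows with fixed j, ordered by i
  × (∀ (j : Fin q) → (toℕ j ≡ 0 ⊎ toℕ j ≡ q ∸ 1) → BadPath p (λ i → T (i , j)))
  -- Y_0 and Y_{p-1} : columns with fixed i, ordered by j
  × (∀ (i : Fin p) → (toℕ i ≡ 0 ⊎ toℕ i ≡ p ∸ 1) → BadPath q (λ j → T (i , j)))
  × (∀ (i : Fin p) (j : Fin q) → 1 ≤ toℕ i → toℕ i ≤ p ∸ 2 →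
       1 ≤ toℕ j → toℕ j ≤ q ∸ 2 → T (i , j) ≡ true)

module Submission where

-- Orientations are recorded by Booleans on the arcs, and the columns are grouped in pairs 2k, 2k+1.
-- For a row j let cups j count, with sign, the pairs whose horizontal arc forms a directed cup with
-- the vertical arcs above it, and caps j the pairs of row j+1 whose arc forms a directed cap over
-- the same vertical arcs.  An acyclic unit square never carries both, so cups j + caps j ≤ 0.  On
-- the other hand the parity conditions of a bad instance give cups 0 ≥ 1, caps (q-2) ≥ 1 and
-- cups (2l+2) + caps 2l ≥ 0; the last propagates cups 2l ≥ 1 up the grid, contradicting
-- cups (q-2) + caps (q-2) ≤ 0.  These three inequalities come from telescoping along a row with a
-- potential that depends only on the arcs between consecutive pairs; the single steps are
-- statements about finitely many Booleans, checked by evaluating them on all inputs.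

open import Defs
open import Data.Bool using (Bool; true; false; not; _∧_; _∨_; _xor_; T; if_then_else_)
open import Data.Bool.Properties using (T-∧; T-≡; T-not-≡; ∧-identityʳ; ∧-zeroʳ; xor-identityʳ; not-involutive)
open import Data.Nat as ℕ using (ℕ; zero; suc; _<_; _∸_; _%_; _<ᵇ_; _≡ᵇ_; z≤n; s≤s)
import Data.Nat.Properties as ℕ
open import Data.Integer using (ℤ; _+_; -_; _≤_; _≤ᵇ_; 0ℤ; 1ℤ; -1ℤ; +≤+)
import Data.Integer.Properties as ℤ
open import Data.Product using (Σ; ∃; _×_; _,_; proj₁; proj₂)
open import Data.Sum as Sum using (_⊎_; inj₁; inj₂)
open import Data.Nat.Divisibility using (_∣_; divides)
open import Data.Vec using (Vec; []; _∷_)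
open import Data.List using ([]; _∷_; map; allFin; tabulate)
open import Data.List.Properties using (map-cong; map-tabulate)
open import Data.Nat.ListAction using (sum)
open import Data.Fin as Fin using (Fin; zero; toℕ; fromℕ<)
open import Data.Fin.Properties using (toℕ-fromℕ<; toℕ-injective; toℕ<n; suc-injective)
open import Data.Maybe using (Maybe; just; nothing; maybe′)
open import Data.Empty using (⊥)
open import Relation.Nullary using (¬_; contradiction; Dec; yes; no)
open import Function using (id; _∘_)
open import Algebra.Properties.CommutativeSemigroup ℤ.+-commutativeSemigroup
  using () renaming (interchange to +-interchange)
open import Algebra.Properties.CommutativeSemigroup ℕ.+-commutativeSemigroup
  using () renaming (interchange to ℕ-interchange)
open import Algebra.Bundles using (AbelianGroup)
open import Algebra.Properties.Group (AbelianGroup.group ℤ.+-0-abelianGroup)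
  using () renaming (//-rightDividesʳ to x+y-y≡x)
open import Function.Bundles using (Equivalence; _⇔_)
open import Relation.Binary.Construct.Closure.Transitive using ([_]; _∷_)
open import Relation.Binary.PropositionalEquality

allBools : ∀ n → (Vec Bool n → Bool) → Bool
allBools zero    f = f []
allBools (suc n) f = allBools n (f ∘ (true ∷_)) ∧ allBools n (f ∘ (false ∷_))

allBools-sound : ∀ n (f : Vec Bool n → Bool) → T (allBools n f) → ∀ xs → T (f xs)
allBools-sound zero    f h [] = h
allBools-sound (suc n) f h (true ∷ xs)  = allBools-sound n _ (proj₁ (Equivalence.to T-∧ h)) xs
allBools-sound (suc n) f h (false ∷ xs) = allBools-sound n _ (proj₂ (Equivalence.to T-∧ h)) xs

infixr 1 _⇒_

_⇒_ : Bool → Bool → Bool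
a ⇒ b = not a ∨ b

modus-ponens : ∀ {a b} → T (a ⇒ b) → T a → T b
modus-ponens {true} a⇒b _ = a⇒b

¬T⇒≡false : ∀ {b} → ¬ T b → b ≡ false
¬T⇒≡false {false} _  = refl
¬T⇒≡false {true}  ¬b = contradiction _ ¬b

⇔⇒≡ : ∀ {x y} → (x ≡ true ⇔ y ≡ true) → x ≡ y
⇔⇒≡ {false} {false} _  = refl
⇔⇒≡ {false} {true}  x⇔ = Equivalence.from x⇔ refl
⇔⇒≡ {true}        x⇔ = sym (Equivalence.to x⇔ refl)

𝟙 : Bool → ℕ
𝟙 b = if b then 1 else 0

⇔-𝟙 : ∀ {b c} → (𝟙 c ≡ 1 ⇔ b ≡ true) → b ≡ c
⇔-𝟙 {c = true}         b⇔ = Equivalence.to b⇔ refl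
⇔-𝟙 {false} {false}    b⇔ = refl
⇔-𝟙 {true}  {false}    b⇔ with Equivalence.from b⇔ refl
... | ()

𝟙-parity : ∀ w x y z → (𝟙 w ℕ.+ 𝟙 x ℕ.+ 𝟙 y ℕ.+ 𝟙 z) % 2 ≡ 𝟙 (w xor x xor y xor z)
𝟙-parity w x y z = ℕ.≡ᵇ⇒≡ _ _ (allBools-sound 4 check _ (w ∷ x ∷ y ∷ z ∷ []))
  where
  check : Vec Bool 4 → Bool
  check (w ∷ x ∷ y ∷ z ∷ []) = (𝟙 w ℕ.+ 𝟙 x ℕ.+ 𝟙 y ℕ.+ 𝟙 z) % 2 ≡ᵇ 𝟙 (w xor x xor y xor z)

𝟙-∧-false : ∀ c {b} → ¬ T b → 𝟙 (c ∧ b) ≡ 0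
𝟙-∧-false false         _  = refl
𝟙-∧-false true  {false} _  = refl
𝟙-∧-false true  {true}  ¬b = contradiction _ ¬b

<ᵇ-true : ∀ {m n} → m < n → (m <ᵇ n) ≡ true
<ᵇ-true = Equivalence.to T-≡ ∘ ℕ.<⇒<ᵇ

<ᵇ-false : ∀ {m n} → ¬ m < n → (m <ᵇ n) ≡ false
<ᵇ-false {m} {n} m≮n = ¬T⇒≡false (m≮n ∘ ℕ.<ᵇ⇒< m n)

≡ᵇ-refl : ∀ n → (n ≡ᵇ n) ≡ true
≡ᵇ-refl n = Equivalence.to T-≡ (ℕ.≡⇒≡ᵇ n n refl)

n≡ᵇ1+n : ∀ n → (n ≡ᵇ suc n) ≡ false
n≡ᵇ1+n zero    = refl
n≡ᵇ1+n (suc n) = n≡ᵇ1+n n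

1+n≡ᵇn : ∀ n → (suc n ≡ᵇ n) ≡ false
1+n≡ᵇn zero    = refl
1+n≡ᵇn (suc n) = 1+n≡ᵇn n

n≡ᵇ2+n : ∀ n → (n ≡ᵇ suc (suc n)) ≡ false
n≡ᵇ2+n zero    = refl
n≡ᵇ2+n (suc n) = n≡ᵇ2+n n

2+n≡ᵇn : ∀ n → (suc (suc n) ≡ᵇ n) ≡ false
2+n≡ᵇn zero    = refl
2+n≡ᵇn (suc n) = 2+n≡ᵇn n

double : ℕ → ℕ
double zero    = zero
double (suc k) = suc (suc (double k))

double-< : ∀ {k n} → k < n → suc (double k) < double n
double-< {zero}  {suc n} _         = s≤s (s≤s z≤n)
double-< {suc k} {suc n} (s≤s k<n) = s≤s (s≤s (double-< k<n))

double≡2* : ∀ n → double n ≡ 2 ℕ.* n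
double≡2* zero    = refl
double≡2* (suc n) = cong suc (trans (cong suc (double≡2* n)) (sym (ℕ.+-suc n (n ℕ.+ 0))))

double-mono-≤ : ∀ {m n} → m ℕ.≤ n → double m ℕ.≤ double n
double-mono-≤ z≤n       = z≤n
double-mono-≤ (s≤s m≤n) = s≤s (s≤s (double-mono-≤ m≤n))

double-<⁻¹ : ∀ {k n} → suc (double k) < double n → k < n
double-<⁻¹ {zero}  {suc n} _                = s≤s z≤n
double-<⁻¹ {suc k} {suc n} (s≤s (s≤s k<n)) = s≤s (double-<⁻¹ k<n)

boundary-< : ∀ {n i} → 0 < n → i ≡ 0 ⊎ i ≡ n ∸ 1 → i < n
boundary-< 0<n      (inj₁ refl) = 0<n
boundary-< (s≤s _)  (inj₂ refl) = ℕ.≤-refl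

halve : ∀ {n} → 2 ∣ n → ∃ λ N → n ≡ double N
halve (divides N n≡N*2) = N , trans n≡N*2 (trans (ℕ.*-comm N 2) (sym (double≡2* N)))

double-pos⁻¹ : ∀ {n} → 0 < double n → 0 < n
double-pos⁻¹ {suc n} _ = s≤s z≤n

sumℤ : ℕ → (ℕ → ℤ) → ℤ
sumℤ zero    f = 0ℤ
sumℤ (suc n) f = sumℤ n f + f n

sumℤ-+ : ∀ n (f g : ℕ → ℤ) → sumℤ n (λ k → f k + g k) ≡ sumℤ n f + sumℤ n g
sumℤ-+ zero    f g = refl
sumℤ-+ (suc n) f g =
  trans (cong (_+ (f n + g n)) (sumℤ-+ n f g)) (+-interchange (sumℤ n f) (sumℤ n g) (f n) (g n))

sumℤ-nonpos : ∀ n (f : ℕ → ℤ) → (∀ k → k < n → f k ≤ 0ℤ) → sumℤ n f ≤ 0ℤ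
sumℤ-nonpos zero    f f≤0 = ℤ.≤-refl
sumℤ-nonpos (suc n) f f≤0 = ℤ.+-mono-≤ (sumℤ-nonpos n f (λ k → f≤0 k ∘ ℕ.m<n⇒m<1+n)) (f≤0 n ℕ.≤-refl)

telescope : ∀ n (φ c : ℕ → ℤ) → (∀ k → k < n → φ (suc k) ≤ φ k + c k) → φ n ≤ φ 0 + sumℤ n c
telescope zero    φ c step = ℤ.≤-reflexive (sym (ℤ.+-identityʳ (φ 0)))
telescope (suc n) φ c step = begin
  φ (suc n)                ≤⟨ step n ℕ.≤-refl ⟩
  φ n + c n                ≤⟨ ℤ.+-monoˡ-≤ (c n) (telescope n φ c (λ k → step k ∘ ℕ.m<n⇒m<1+n)) ⟩
  φ 0 + sumℤ n c + c n     ≡⟨ ℤ.+-assoc (φ 0) (sumℤ n c) (c n) ⟩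
  φ 0 + sumℤ (suc n) c     ∎
  where open ℤ.≤-Reasoning

1≤-transfer : ∀ {x y z} → 1ℤ ≤ x → x + y ≤ 0ℤ → 0ℤ ≤ z + y → 1ℤ ≤ z
1≤-transfer {x} {y} {z} 1≤x x+y≤0 0≤z+y = subst₂ _≤_ (x+y-y≡x y 1ℤ) (x+y-y≡x y z)
  (ℤ.+-monoˡ-≤ (- y) (ℤ.≤-trans (ℤ.≤-trans (ℤ.+-monoˡ-≤ y 1≤x) x+y≤0) 0≤z+y))

1≤-sum-nonpos : ∀ {x y} → 1ℤ ≤ x → 1ℤ ≤ y → ¬ x + y ≤ 0ℤ
1≤-sum-nonpos 1≤x 1≤y x+y≤0 with ℤ.≤-trans (ℤ.+-mono-≤ 1≤x 1≤y) x+y≤0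
... | +≤+ ()

-- Local configurations of arcs

-- Arcs are Booleans: true means pointing right for horizontal arcs and up for vertical ones.
-- For a horizontal arc h carrying the vertical arcs a and b above its left and right ends,
-- cup h a b is 1 if the three form a directed path, -1 if a and b are antiparallel but h points
-- against them, and 0 if a and b are parallel; cap is the same with a and b below h.
cup : Bool → Bool → Bool → ℤ
cup h a b = if a xor b then (if h xor b then -1ℤ else 1ℤ) else 0ℤ

cap : Bool → Bool → Bool → ℤ
cap h a b = cup h (not a) (not b)

counterclockwise clockwise acyclicSquare : (bottom top left right : Bool) → Bool
counterclockwise bottom top left right = bottom ∧ right ∧ not top ∧ not left
clockwise        bottom top left right = not bottom ∧ not right ∧ top ∧ left
acyclicSquare    bottom top left right =
  not (counterclockwise bottom top left right) ∧ not (clockwise bottom top left right)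

counterclockwise-sound : ∀ {b t l r} → T (counterclockwise b t l r) →
                         b ≡ true × r ≡ true × t ≡ false × l ≡ false
counterclockwise-sound {true} {false} {false} {true}  _  = refl , refl , refl , refl
counterclockwise-sound {false}                        ()
counterclockwise-sound {true} {_}     {_}     {false} ()
counterclockwise-sound {true} {true}  {_}     {true}  ()
counterclockwise-sound {true} {false} {true}  {true}  ()

clockwise-sound : ∀ {b t l r} → T (clockwise b t l r) → b ≡ false × r ≡ false × t ≡ true × l ≡ true
clockwise-sound {false} {true}  {true}  {false} _  = refl , refl , refl , refl
clockwise-sound {true}                          ()
clockwise-sound {false} {_}     {_}     {true}  ()
clockwise-sound {false} {false} {_}     {false} ()
clockwise-sound {false} {true}  {false} {false} ()

acyclicSquare-intro : ∀ b t l r → ¬ T (counterclockwise b t l r) → ¬ T (clockwise b t l r) →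
                      T (acyclicSquare b t l r)
acyclicSquare-intro b t l r ¬ccw ¬cw = Equivalence.from T-∧ (T-not ¬ccw , T-not ¬cw)
  where
  T-not : ∀ {x} → ¬ T x → T (not x)
  T-not = Equivalence.from T-not-≡ ∘ ¬T⇒≡false

cup+cap≤0 : ∀ bottom top left right → T (acyclicSquare bottom top left right) →
            cup bottom left right + cap top left right ≤ 0ℤ
cup+cap≤0 b t l r = ℤ.≤ᵇ⇒≤ ∘ modus-ponens (allBools-sound 4 check _ (b ∷ t ∷ l ∷ r ∷ []))
  where
  check : Vec Bool 4 → Bool
  check (b ∷ t ∷ l ∷ r ∷ []) = acyclicSquare b t l r ⇒ cup b l r + cap t l r ≤ᵇ 0ℤ

agree : Bool → Bool → ℤ
agree g t = if g xor t then 0ℤ else 1ℤ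

-- One pair of columns of a boundary row: gl and gr are the arcs entering this pair and the next
-- from the left, h the arc inside the pair, w₀ and w₁ its vertical arcs, t₀ and t₁ its parities.
boundaryPair-step : ∀ gl h gr w₀ w₁ {t₀ t₁} →
                    t₀ ≡ gl xor not h xor not w₀ → t₁ ≡ h xor not gr xor not w₁ →
                    agree gr t₁ ≤ agree gl t₀ + cup h w₀ w₁
boundaryPair-step gl h gr w₀ w₁ refl refl =
  ℤ.≤ᵇ⇒≤ (allBools-sound 5 check _ (gl ∷ h ∷ gr ∷ w₀ ∷ w₁ ∷ []))
  where
  check : Vec Bool 5 → Bool
  check (gl ∷ h ∷ gr ∷ w₀ ∷ w₁ ∷ []) =
    agree gr (h xor not gr xor not w₁) ≤ᵇ agree gl (gl xor not h xor not w₀) + cup h w₀ w₁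

-- A column with parities t and s in two consecutive rows, entered from the left by g₁ and g₂:
-- either both parities are odd, or it is the first (e = false) or last (e = true) column.
admissibleColumn : (e t s g₁ g₂ : Bool) → Bool
admissibleColumn e t s g₁ g₂ = (t ∧ s) ∨ (not (t xor s) ∧ not (g₁ xor e) ∧ not (g₂ xor e))

-- The same for two consecutive rows, with vertical arcs a below, m between and b above them;
-- ml is the arc between the rows in the column left of the pair.
doublePair-step : ∀ gl₁ gl₂ ml h₁ h₂ gr₁ gr₂ a₀ a₁ m₀ m₁ b₀ b₁ {t₀ t₁ s₀ s₁} →
  t₀ ≡ gl₁ xor not h₁ xor a₀ xor not m₀ → t₁ ≡ h₁ xor not gr₁ xor a₁ xor not m₁ →
  s₀ ≡ gl₂ xor not h₂ xor m₀ xor not b₀ → s₁ ≡ h₂ xor not gr₂ xor m₁ xor not b₁ →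
  T (admissibleColumn false t₀ s₀ gl₁ gl₂) → T (admissibleColumn true t₁ s₁ gr₁ gr₂) →
  T (acyclicSquare gl₁ gl₂ ml m₀) → T (acyclicSquare h₁ h₂ m₀ m₁) →
  cap m₁ gr₁ gr₂ ≤ cap ml gl₁ gl₂ + (cup h₂ b₀ b₁ + cap h₁ a₀ a₁)
doublePair-step gl₁ gl₂ ml h₁ h₂ gr₁ gr₂ a₀ a₁ m₀ m₁ b₀ b₁ refl refl refl refl col₀ col₁ sq₀ sq₁ =
  ℤ.≤ᵇ⇒≤ (modus-ponens (modus-ponens (modus-ponens (modus-ponens
    (allBools-sound 13 check _ (gl₁ ∷ gl₂ ∷ ml ∷ h₁ ∷ h₂ ∷ gr₁ ∷ gr₂ ∷ a₀ ∷ a₁ ∷ m₀ ∷ m₁ ∷ b₀ ∷ b₁ ∷ []))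
    col₀) col₁) sq₀) sq₁)
  where
  check : Vec Bool 13 → Bool
  check (gl₁ ∷ gl₂ ∷ ml ∷ h₁ ∷ h₂ ∷ gr₁ ∷ gr₂ ∷ a₀ ∷ a₁ ∷ m₀ ∷ m₁ ∷ b₀ ∷ b₁ ∷ []) =
    admissibleColumn false (gl₁ xor not h₁ xor a₀ xor not m₀) (gl₂ xor not h₂ xor m₀ xor not b₀) gl₁ gl₂ ⇒
    admissibleColumn true (h₁ xor not gr₁ xor a₁ xor not m₁) (h₂ xor not gr₂ xor m₁ xor not b₁) gr₁ gr₂ ⇒
    acyclicSquare gl₁ gl₂ ml m₀ ⇒ acyclicSquare h₁ h₂ m₀ m₁ ⇒
    cap m₁ gr₁ gr₂ ≤ᵇ cap ml gl₁ gl₂ + (cup h₂ b₀ b₁ + cap h₁ a₀ a₁)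

admissibleColumn-odd : ∀ e {t s} g₁ g₂ → t ≡ true → s ≡ true → T (admissibleColumn e t s g₁ g₂)
admissibleColumn-odd e g₁ g₂ refl refl = _

admissibleColumn-end : ∀ e {t s} → t ≡ s → T (admissibleColumn e t s e e)
admissibleColumn-end false {false} refl = _
admissibleColumn-end false {true}  refl = _
admissibleColumn-end true  {false} refl = _
admissibleColumn-end true  {true}  refl = _

acyclicSquare-outwards : ∀ left right → T (acyclicSquare false false left right)
acyclicSquare-outwards left false = _
acyclicSquare-outwards left true  = _

-- Telescoping along rows

-- The orientation of a path 0 , 1 , … , n-1 is h : ℕ → Bool, with h i true iff the edge between i
-- and i+1 points to i+1; inPrev and inNext say whether the edges at i from i-1 and i+1 enter i.
inPrev : (ℕ → Bool) → ℕ → Bool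
inPrev h zero    = false
inPrev h (suc i) = h i

inNext : ℕ → (ℕ → Bool) → ℕ → Bool
inNext n h i = (suc i <ᵇ n) ∧ not (h i)

-- On a path with 2P vertices grouped into the pairs 2k , 2k+1, the edge entering pair k from the
-- left; the missing edges before the first and after the last pair count as pointing outwards.
pairEntry : ℕ → (ℕ → Bool) → ℕ → Bool
pairEntry P h zero    = false
pairEntry P h (suc k) = if suc k <ᵇ P then h (suc (double k)) else true

inNext-last : ∀ n h → inNext (suc n) h n ≡ false
inNext-last n h rewrite <ᵇ-false (ℕ.<-irrefl {suc n} refl) = refl

pairEntry-inner : ∀ {P} h k → suc k < P → pairEntry P h (suc k) ≡ h (suc (double k))
pairEntry-inner h k k+1<P rewrite <ᵇ-true k+1<P = refl

pairEntry-last : ∀ h k → pairEntry (suc k) h (suc k) ≡ true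
pairEntry-last h k rewrite <ᵇ-false (ℕ.<-irrefl {suc k} refl) = refl

inPrev-double : ∀ {P} h k → k < P → inPrev h (double k) ≡ pairEntry P h k
inPrev-double h zero    _   = refl
inPrev-double h (suc k) k<P = sym (pairEntry-inner h k k<P)

inNext-double : ∀ {P} h k → k < P → inNext (double P) h (double k) ≡ not (h (double k))
inNext-double h k k<P rewrite <ᵇ-true (double-< k<P) = refl

inNext-suc-double : ∀ {P} h k → k < P → inNext (double P) h (suc (double k)) ≡ not (pairEntry P h (suc k))
inNext-suc-double {P} h k k<P with ℕ.m≤n⇒m<n∨m≡n k<P
... | inj₁ k+1<P rewrite <ᵇ-true (ℕ.<⇒≤ (double-< k+1<P)) | <ᵇ-true k+1<P = refl
... | inj₂ refl  rewrite <ᵇ-false (ℕ.<-irrefl {double P} refl) | pairEntry-last h k = refl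

-- t is the T-odd labelling of a row of n vertices, v i the parity of the vertical arcs entering i.
RowParity : ℕ → (h v t : ℕ → Bool) → Set
RowParity n h v t = ∀ i → i < n → t i ≡ inPrev h i xor inNext n h i xor v i

record IsBadPath (P : ℕ) (t : ℕ → Bool) : Set where
  field
    first  : t 0 ≡ true
    last   : t (double P ∸ 1) ≡ true
    paired : ∀ k → suc k < P → t (suc (double k)) ≡ t (double (suc k))

cups caps : ℕ → (h v : ℕ → Bool) → ℤ
cups P h v = sumℤ P (λ k → cup (h (double k)) (v (double k)) (v (suc (double k))))
caps P h v = cups P h (not ∘ v)

RowParity-even : ∀ {P h v t} → RowParity (double P) h v t → ∀ k → k < P →
                 t (double k) ≡ pairEntry P h k xor not (h (double k)) xor v (double k)
RowParity-even {h = h} {v} parity k k<P =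
  trans (parity (double k) (ℕ.<⇒≤ (double-< k<P)))
        (cong₂ (λ x y → x xor y xor v (double k)) (inPrev-double h k k<P) (inNext-double h k k<P))

RowParity-odd : ∀ {P h v t} → RowParity (double P) h v t → ∀ k → k < P →
                t (suc (double k)) ≡ h (double k) xor not (pairEntry P h (suc k)) xor v (suc (double k))
RowParity-odd {h = h} {v} parity k k<P =
  trans (parity (suc (double k)) (double-< k<P))
        (cong (λ y → h (double k) xor y xor v (suc (double k))) (inNext-suc-double h k k<P))

-- The potential is the agreement of the arc entering pair k with the parity t (2k-1) = t (2k).
boundaryRow-cups : ∀ P (h w t : ℕ → Bool) → 0 < P →
                   RowParity (double P) h (not ∘ w) t → IsBadPath P t → 1ℤ ≤ cups P h w
boundaryRow-cups P@(suc P′) h w t _ parity bad =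
  subst₂ _≤_ agree-last (trans (cong (_+ cups P h w) agree-first) (ℤ.+-identityˡ _))
             (telescope P φ c step)
  where
  open IsBadPath bad
  E : ℕ → Bool
  E = pairEntry P h
  τ : ℕ → Bool
  τ zero    = t 0
  τ (suc k) = t (suc (double k))
  φ c : ℕ → ℤ
  φ k = agree (E k) (τ k)
  c k = cup (h (double k)) (w (double k)) (w (suc (double k)))
  τ-double : ∀ k → k < P → τ k ≡ t (double k)
  τ-double zero    _   = refl
  τ-double (suc k) k<P = paired k k<P
  step : ∀ k → k < P → φ (suc k) ≤ φ k + c k
  step k k<P = boundaryPair-step (E k) (h (double k)) (E (suc k)) (w (double k)) (w (suc (double k)))
    (trans (τ-double k k<P) (RowParity-even parity k k<P)) (RowParity-odd parity k k<P)
  agree-first : φ 0 ≡ 0ℤ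
  agree-first rewrite first = refl
  agree-last : φ P ≡ 1ℤ
  agree-last rewrite pairEntry-last h P′ | last = refl

-- The potential is the cap formed by the arcs entering pair k in both rows, hanging from the
-- vertical arc between the rows at column 2k-1.
doubleRow-cups+caps : ∀ P (h₁ h₂ a m b t₁ t₂ : ℕ → Bool) → 0 < P →
  RowParity (double P) h₁ (λ i → a i xor not (m i)) t₁ →
  RowParity (double P) h₂ (λ i → m i xor not (b i)) t₂ →
  (∀ i → suc i < double P → T (acyclicSquare (h₁ i) (h₂ i) (m i) (m (suc i)))) →
  (∀ i → 0 < i → suc i < double P → t₁ i ≡ true) →
  (∀ i → 0 < i → suc i < double P → t₂ i ≡ true) →
  t₁ 0 ≡ t₂ 0 → t₁ (double P ∸ 1) ≡ t₂ (double P ∸ 1) →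
  0ℤ ≤ cups P h₂ b + caps P h₁ a
doubleRow-cups+caps P@(suc P′) h₁ h₂ a m b t₁ t₂ _ parity₁ parity₂ squares odd₁ odd₂ first last =
  subst₂ _≤_ cap-last (trans (ℤ.+-identityˡ _) (sumℤ-+ P _ _)) (telescope P φ c step)
  where
  E₁ E₂ : ℕ → Bool
  E₁ = pairEntry P h₁
  E₂ = pairEntry P h₂
  M : ℕ → Bool
  M zero    = false
  M (suc k) = m (suc (double k))
  φ c : ℕ → ℤ
  φ k = cap (M k) (E₁ k) (E₂ k)
  c k = cup (h₂ (double k)) (b (double k)) (b (suc (double k)))
      + cap (h₁ (double k)) (a (double k)) (a (suc (double k)))
  leftColumn : ∀ k → k < P → T (admissibleColumn false (t₁ (double k)) (t₂ (double k)) (E₁ k) (E₂ k))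
  leftColumn zero    _   = admissibleColumn-end false first
  leftColumn (suc k) k<P = admissibleColumn-odd false (E₁ (suc k)) (E₂ (suc k))
    (odd₁ _ (s≤s z≤n) (double-< k<P)) (odd₂ _ (s≤s z≤n) (double-< k<P))
  rightColumn : ∀ k → k < P →
    T (admissibleColumn true (t₁ (suc (double k))) (t₂ (suc (double k))) (E₁ (suc k)) (E₂ (suc k)))
  rightColumn k k<P with ℕ.m≤n⇒m<n∨m≡n k<P
  ... | inj₁ k+1<P = admissibleColumn-odd true (E₁ (suc k)) (E₂ (suc k))
    (odd₁ _ (s≤s z≤n) (ℕ.<⇒≤ (double-< k+1<P))) (odd₂ _ (s≤s z≤n) (ℕ.<⇒≤ (double-< k+1<P)))
  ... | inj₂ refl rewrite pairEntry-last h₁ P′ | pairEntry-last h₂ P′ = admissibleColumn-end true last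
  leftSquare : ∀ k → k < P → T (acyclicSquare (E₁ k) (E₂ k) (M k) (m (double k)))
  leftSquare zero    _   = acyclicSquare-outwards false (m 0)
  leftSquare (suc k) k<P rewrite pairEntry-inner h₁ k k<P | pairEntry-inner h₂ k k<P =
    squares (suc (double k)) (ℕ.<⇒≤ (double-< k<P))
  step : ∀ k → k < P → φ (suc k) ≤ φ k + c k
  step k k<P = doublePair-step (E₁ k) (E₂ k) (M k) (h₁ (double k)) (h₂ (double k)) (E₁ (suc k)) (E₂ (suc k))
    (a (double k)) (a (suc (double k))) (m (double k)) (m (suc (double k))) (b (double k)) (b (suc (double k)))
    (RowParity-even parity₁ k k<P) (RowParity-odd parity₁ k k<P)
    (RowParity-even parity₂ k k<P) (RowParity-odd parity₂ k k<P)
    (leftColumn k k<P) (rightColumn k k<P) (leftSquare k k<P) (squares (double k) (double-< k<P))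
  cap-last : φ P ≡ 0ℤ
  cap-last rewrite pairEntry-last h₁ P′ | pairEntry-last h₂ P′ = refl

cups+caps-nonpos : ∀ P (h h′ v : ℕ → Bool) →
  (∀ k → k < P → T (acyclicSquare (h (double k)) (h′ (double k)) (v (double k)) (v (suc (double k))))) →
  cups P h v + caps P h′ v ≤ 0ℤ
cups+caps-nonpos P h h′ v acyclic = subst (_≤ 0ℤ) (sumℤ-+ P _ _)
  (sumℤ-nonpos P _ λ k k<P →
    cup+cap≤0 (h (double k)) (h′ (double k)) (v (double k)) (v (suc (double k))) (acyclic k k<P))

module BadGridℕ (P Q : ℕ) (right up t : ℕ → ℕ → Bool)
  (parity : ∀ j → j < double Q → RowParity (double P) (λ i → right i j)
                                     (λ i → inPrev (up i) j xor inNext (double Q) (up i) j) (λ i → t i j))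
  (squares : ∀ i j → suc i < double P → suc j < double Q →
             T (acyclicSquare (right i j) (right i (suc j)) (up i j) (up (suc i) j)))
  (boundaryRows : ∀ j → j ≡ 0 ⊎ j ≡ double Q ∸ 1 → IsBadPath P (λ i → t i j))
  (boundaryColumns : ∀ i → i ≡ 0 ⊎ i ≡ double P ∸ 1 → IsBadPath Q (t i))
  (interior : ∀ i j → 0 < i → suc i < double P → 0 < j → suc j < double Q → t i j ≡ true)
  (0<P : 0 < P)
  where

  rowCups stripCaps : ℕ → ℤ
  rowCups   j = cups P (λ i → right i j) (λ i → up i j)
  stripCaps j = caps P (λ i → right i (suc j)) (λ i → up i j)

  strip-nonpos : ∀ j → suc j < double Q → rowCups j + stripCaps j ≤ 0ℤ
  strip-nonpos j j+1<2Q = cups+caps-nonpos P (λ i → right i j) (λ i → right i (suc j)) (λ i → up i j)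
    (λ k k<P → squares (double k) j (double-< k<P) j+1<2Q)

  lowerRowParity : ∀ j → suc j < double Q →
    RowParity (double P) (λ i → right i j) (λ i → inPrev (up i) j xor not (up i j)) (λ i → t i j)
  lowerRowParity j j+1<2Q i i<2P =
    subst (λ b → t i j ≡ inPrev h i xor inNext (double P) h i xor (inPrev (up i) j xor (b ∧ not (up i j))))
          (<ᵇ-true j+1<2Q) (parity j (ℕ.<⇒≤ j+1<2Q) i i<2P)
    where
    h : ℕ → Bool
    h x = right x j

  bottom-cups : 1 < double Q → 1ℤ ≤ rowCups 0
  bottom-cups 1<2Q = boundaryRow-cups P (λ i → right i 0) (λ i → up i 0) (λ i → t i 0) 0<P
                       (lowerRowParity 0 1<2Q) (boundaryRows 0 (inj₁ refl))

  top-caps : ∀ {Q′} → Q ≡ suc Q′ → 1ℤ ≤ stripCaps (double Q′)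
  top-caps {Q′} refl = boundaryRow-cups P h (λ i → not (up i (double Q′))) (λ i → t i top) 0<P topParity
                         (boundaryRows top (inj₂ refl))
    where
    top : ℕ
    top = suc (double Q′)
    h : ℕ → Bool
    h i = right i top
    topParity : RowParity (double P) h (λ i → not (not (up i (double Q′)))) (λ i → t i top)
    topParity i i<2P = begin
      t i top                                          ≡⟨ parity top ℕ.≤-refl i i<2P ⟩
      L xor R xor (d xor inNext (suc top) (up i) top)  ≡⟨ cong (λ x → L xor R xor (d xor x)) (inNext-last top (up i)) ⟩
      L xor R xor (d xor false)                        ≡⟨ cong (λ x → L xor R xor x) (xor-identityʳ d) ⟩
      L xor R xor d                                    ≡⟨ cong (λ x → L xor R xor x) (not-involutive d) ⟨
      L xor R xor not (not d)                          ∎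
      where
      open ≡-Reasoning
      L R d : Bool
      L = inPrev h i
      R = inNext (double P) h i
      d = up i (double Q′)

  doubleRow-nonneg : ∀ l → suc (double (suc l)) < double Q →
                     0ℤ ≤ rowCups (double (suc l)) + stripCaps (double l)
  doubleRow-nonneg l r₂+1<2Q = doubleRow-cups+caps P (λ i → right i r₁) (λ i → right i r₂)
    (λ i → up i (double l)) (λ i → up i r₁) (λ i → up i r₂) (λ i → t i r₁) (λ i → t i r₂) 0<P
    (lowerRowParity r₁ r₁+1<2Q) (lowerRowParity r₂ r₂+1<2Q)
    (λ i i+1<2P → squares i r₁ i+1<2P r₁+1<2Q)
    (λ i 0<i i+1<2P → interior i r₁ 0<i i+1<2P (s≤s z≤n) r₁+1<2Q)
    (λ i 0<i i+1<2P → interior i r₂ 0<i i+1<2P (s≤s z≤n) r₂+1<2Q)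
    (IsBadPath.paired (boundaryColumns 0 (inj₁ refl)) l l+1<Q)
    (IsBadPath.paired (boundaryColumns (double P ∸ 1) (inj₂ refl)) l l+1<Q)
    where
    r₁ r₂ : ℕ
    r₁ = suc (double l)
    r₂ = double (suc l)
    r₁+1<2Q : suc r₁ < double Q
    r₁+1<2Q = ℕ.<⇒≤ r₂+1<2Q
    l+1<Q : suc l < Q
    l+1<Q = double-<⁻¹ r₂+1<2Q

  rowCups-positive : ∀ l → suc (double l) < double Q → 1ℤ ≤ rowCups (double l)
  rowCups-positive zero    1<2Q    = bottom-cups 1<2Q
  rowCups-positive (suc l) r₂+1<2Q =
    1≤-transfer (rowCups-positive l r₁<2Q) (strip-nonpos (double l) r₁<2Q) (doubleRow-nonneg l r₂+1<2Q)
    where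
    r₁<2Q : suc (double l) < double Q
    r₁<2Q = ℕ.<⇒≤ (ℕ.<⇒≤ r₂+1<2Q)

  impossible : 0 < Q → ⊥
  impossible (s≤s {n = Q′} z≤n) =
    1≤-sum-nonpos (rowCups-positive Q′ ℕ.≤-refl) (top-caps refl) (strip-nonpos (double Q′) ℕ.≤-refl)

-- In-degrees in P_p □ P_q

sum-map-+ : ∀ {A : Set} (f g : A → ℕ) xs →
            sum (map (λ x → f x ℕ.+ g x) xs) ≡ sum (map f xs) ℕ.+ sum (map g xs)
sum-map-+ f g []       = refl
sum-map-+ f g (x ∷ xs) = trans (cong (f x ℕ.+ g x ℕ.+_) (sum-map-+ f g xs))
                               (ℕ-interchange (f x) (g x) (sum (map f xs)) (sum (map g xs)))

sum-map-zero : ∀ {A : Set} (f : A → ℕ) xs → (∀ x → f x ≡ 0) → sum (map f xs) ≡ 0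
sum-map-zero f []       _   = refl
sum-map-zero f (x ∷ xs) f≡0 = cong₂ ℕ._+_ (f≡0 x) (sum-map-zero f xs f≡0)

sum-tabulate-zero : ∀ {n} (f : Fin n → ℕ) → (∀ x → f x ≡ 0) → sum (tabulate f) ≡ 0
sum-tabulate-zero f f≡0 = trans (cong sum (sym (map-tabulate id f))) (sum-map-zero f (allFin _) f≡0)

sum-tabulate-point : ∀ {n} (f : Fin n → ℕ) a → (∀ x → x ≢ a → f x ≡ 0) → sum (tabulate f) ≡ f a
sum-tabulate-point f zero        off =
  trans (cong (f zero ℕ.+_) (sum-tabulate-zero (f ∘ Fin.suc) λ x → off (Fin.suc x) λ ())) (ℕ.+-identityʳ (f zero))
sum-tabulate-point f (Fin.suc a) off = cong₂ ℕ._+_ (off zero λ ())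
  (sum-tabulate-point (f ∘ Fin.suc) a λ x x≢a → off (Fin.suc x) (x≢a ∘ suc-injective))

sum-allFin-point : ∀ {n} (f : Fin n → ℕ) a → (∀ x → x ≢ a → f x ≡ 0) → sum (map f (allFin n)) ≡ f a
sum-allFin-point f a off = trans (cong sum (map-tabulate id f)) (sum-tabulate-point f a off)

neighbour-classes : ∀ {I J i j} →
  (I ≡ i × (suc J ≡ j ⊎ suc j ≡ J)) ⊎ (J ≡ j × (suc I ≡ i ⊎ suc i ≡ I)) →
  𝟙 ((suc I ≡ᵇ i) ∧ (J ≡ᵇ j)) ℕ.+ 𝟙 ((I ≡ᵇ suc i) ∧ (J ≡ᵇ j)) ℕ.+
  𝟙 ((I ≡ᵇ i) ∧ (suc J ≡ᵇ j)) ℕ.+ 𝟙 ((I ≡ᵇ i) ∧ (J ≡ᵇ suc j)) ≡ 1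
neighbour-classes {I} {J} (inj₁ (refl , inj₁ refl))
  rewrite ≡ᵇ-refl I | ≡ᵇ-refl J | 1+n≡ᵇn I | n≡ᵇ1+n I | n≡ᵇ2+n J = refl
neighbour-classes {I} {j = j} (inj₁ (refl , inj₂ refl))
  rewrite ≡ᵇ-refl I | ≡ᵇ-refl j | 1+n≡ᵇn I | n≡ᵇ1+n I | 2+n≡ᵇn j = refl
neighbour-classes {I} {J} (inj₂ (refl , inj₁ refl))
  rewrite ≡ᵇ-refl I | ≡ᵇ-refl J | n≡ᵇ2+n I | n≡ᵇ1+n I = refl
neighbour-classes {J = J} {i} (inj₂ (refl , inj₂ refl))
  rewrite ≡ᵇ-refl i | ≡ᵇ-refl J | 2+n≡ᵇn i | 1+n≡ᵇn i = refl

∑V : ∀ {p q} → (Vertex p q → ℕ) → ℕ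
∑V {p} {q} f = sum (map (λ a → sum (map (λ b → f (a , b)) (allFin q))) (allFin p))

module _ {p q : ℕ} where

  ∑V-cong : ∀ {f g : Vertex p q → ℕ} → (∀ u → f u ≡ g u) → ∑V f ≡ ∑V g
  ∑V-cong f≗g = cong sum (map-cong (λ a → cong sum (map-cong (λ b → f≗g (a , b)) (allFin q))) (allFin p))

  ∑V-+ : ∀ (f g : Vertex p q → ℕ) → ∑V (λ u → f u ℕ.+ g u) ≡ ∑V f ℕ.+ ∑V g
  ∑V-+ f g =
    trans (cong sum (map-cong (λ a → sum-map-+ (λ b → f (a , b)) (λ b → g (a , b)) (allFin q)) (allFin p)))
          (sum-map-+ _ _ (allFin p))

  ∑V-zero : ∀ (f : Vertex p q → ℕ) → (∀ u → f u ≡ 0) → ∑V f ≡ 0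
  ∑V-zero f f≡0 = sum-map-zero _ (allFin p) (λ a → sum-map-zero _ (allFin q) (λ b → f≡0 (a , b)))

  ∑V-point : ∀ (f : Vertex p q → ℕ) w → (∀ u → u ≢ w → f u ≡ 0) → ∑V f ≡ f w
  ∑V-point f (a , b) off =
    trans (sum-allFin-point _ a λ a′ a′≢a → sum-map-zero _ (allFin q) λ b′ → off (a′ , b′) (a′≢a ∘ cong proj₁))
          (sum-allFin-point _ b λ b′ b′≢b → off (a , b′) (b′≢b ∘ cong proj₂))

  vertex : ∀ {i j} → i < p → j < q → Vertex p q
  vertex i<p j<q = (fromℕ< i<p , fromℕ< j<q)

  vertexAt : ℕ → ℕ → Maybe (Vertex p q)
  vertexAt i j with i ℕ.<? p | j ℕ.<? q
  ... | yes i<p | yes j<q = just (vertex i<p j<q)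
  ... | _       | _       = nothing

  vertexAt-just : ∀ {i j} (i<p : i < p) (j<q : j < q) → vertexAt i j ≡ just (vertex i<p j<q)
  vertexAt-just {i} {j} i<p j<q with i ℕ.<? p | j ℕ.<? q
  ... | yes _   | yes _   = refl
  ... | no i≮p  | _       = contradiction i<p i≮p
  ... | yes _   | no j≮q  = contradiction j<q j≮q

  labelAt : (Vertex p q → Bool) → ℕ → ℕ → Bool
  labelAt S i j = maybe′ S false (vertexAt i j)

  isAt : ℕ → ℕ → Vertex p q → Bool
  isAt i j u = (toℕ (proj₁ u) ≡ᵇ i) ∧ (toℕ (proj₂ u) ≡ᵇ j)

  isAt-sound : ∀ {i j} u → T (isAt i j u) → toℕ (proj₁ u) ≡ i × toℕ (proj₂ u) ≡ j
  isAt-sound (a , b) at with Equivalence.to T-∧ at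
  ... | at₁ , at₂ = ℕ.≡ᵇ⇒≡ _ _ at₁ , ℕ.≡ᵇ⇒≡ _ _ at₂

  ∑V-isAt : ∀ i j (f : Vertex p q → Bool) → ∑V (λ u → 𝟙 (f u ∧ isAt i j u)) ≡ 𝟙 (maybe′ f false (vertexAt i j))
  ∑V-isAt i j f with i ℕ.<? p | j ℕ.<? q
  ... | yes i<p | yes j<q =
    trans (∑V-point _ w elsewhere) (trans (cong (λ b → 𝟙 (f w ∧ b)) at-w) (cong 𝟙 (∧-identityʳ (f w))))
    where
    w : Vertex p q
    w = vertex i<p j<q
    at-w : isAt i j w ≡ true
    at-w rewrite toℕ-fromℕ< i<p | toℕ-fromℕ< j<q | ≡ᵇ-refl i | ≡ᵇ-refl j = refl
    elsewhere : ∀ u → u ≢ w → 𝟙 (f u ∧ isAt i j u) ≡ 0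
    elsewhere u u≢w = 𝟙-∧-false (f u) λ at → let (eᵢ , eⱼ) = isAt-sound u at in u≢w (cong₂ _,_
      (toℕ-injective (trans eᵢ (sym (toℕ-fromℕ< i<p)))) (toℕ-injective (trans eⱼ (sym (toℕ-fromℕ< j<q)))))
  ... | no i≮p | _ = ∑V-zero _ λ u → 𝟙-∧-false (f u) λ at →
    i≮p (subst (_< p) (proj₁ (isAt-sound u at)) (toℕ<n (proj₁ u)))
  ... | yes _ | no j≮q = ∑V-zero _ λ u → 𝟙-∧-false (f u) λ at →
    j≮q (subst (_< q) (proj₂ (isAt-sound u at)) (toℕ<n (proj₂ u)))

  vertexAt-outˡ : ∀ {i j} → ¬ i < p → vertexAt i j ≡ nothing
  vertexAt-outˡ {i} {j} i≮p with i ℕ.<? p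
  ... | yes i<p = contradiction i<p i≮p
  ... | no _    = refl

  vertexAt-outʳ : ∀ {i j} → ¬ j < q → vertexAt i j ≡ nothing
  vertexAt-outʳ {i} {j} j≮q with i ℕ.<? p | j ℕ.<? q
  ... | yes _ | yes j<q = contradiction j<q j≮q
  ... | yes _ | no _    = refl
  ... | no _  | _       = refl

  adjacent-right : ∀ {i j} (i<p : i < p) (i+1<p : suc i < p) (j<q : j < q) →
                   GridAdj (vertex i<p j<q) (vertex i+1<p j<q)
  adjacent-right i<p i+1<p j<q = inj₂ (refl , inj₁ (trans (cong suc (toℕ-fromℕ< i<p)) (sym (toℕ-fromℕ< i+1<p))))

  adjacent-up : ∀ {i j} (i<p : i < p) (j<q : j < q) (j+1<q : suc j < q) →
                GridAdj (vertex i<p j<q) (vertex i<p j+1<q)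
  adjacent-up i<p j<q j+1<q = inj₁ (refl , inj₁ (trans (cong suc (toℕ-fromℕ< j<q)) (sym (toℕ-fromℕ< j+1<q))))

  leftOf belowOf : ℕ → ℕ → Vertex p q → Bool
  leftOf  i j u = (suc (toℕ (proj₁ u)) ≡ᵇ i) ∧ (toℕ (proj₂ u) ≡ᵇ j)
  belowOf i j u = (toℕ (proj₁ u) ≡ᵇ i) ∧ (suc (toℕ (proj₂ u)) ≡ᵇ j)

  neighbour-position : ∀ {i j} (i<p : i < p) (j<q : j < q) u → GridAdj u (vertex i<p j<q) →
    𝟙 (leftOf i j u) ℕ.+ 𝟙 (isAt (suc i) j u) ℕ.+ 𝟙 (belowOf i j u) ℕ.+ 𝟙 (isAt i (suc j) u) ≡ 1
  neighbour-position {i} {j} i<p j<q (a , b) adj = neighbour-classes (position adj)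
    where
    position : GridAdj (a , b) (vertex i<p j<q) →
      (toℕ a ≡ i × (suc (toℕ b) ≡ j ⊎ suc j ≡ toℕ b)) ⊎ (toℕ b ≡ j × (suc (toℕ a) ≡ i ⊎ suc i ≡ toℕ a))
    position (inj₁ (refl , inj₁ e)) = inj₁ (toℕ-fromℕ< i<p , inj₁ (trans e (toℕ-fromℕ< j<q)))
    position (inj₁ (refl , inj₂ e)) = inj₁ (toℕ-fromℕ< i<p , inj₂ (trans (cong suc (sym (toℕ-fromℕ< j<q))) e))
    position (inj₂ (refl , inj₁ e)) = inj₂ (toℕ-fromℕ< j<q , inj₁ (trans e (toℕ-fromℕ< i<p)))
    position (inj₂ (refl , inj₂ e)) = inj₂ (toℕ-fromℕ< j<q , inj₂ (trans (cong suc (sym (toℕ-fromℕ< i<p))) e))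

module OrientationView {p q : ℕ} (o : Orientation p q) where

  -- Arcs with an endpoint outside the grid read as false.
  arcAt : Maybe (Vertex p q) → Maybe (Vertex p q) → Bool
  arcAt (just u) (just v) = dir o u v
  arcAt _        _        = false

  right up : ℕ → ℕ → Bool
  right i j = arcAt (vertexAt i j) (vertexAt (suc i) j)
  up    i j = arcAt (vertexAt i j) (vertexAt i (suc j))

  arcAt-into : ∀ m v → maybe′ (λ u → dir o u v) false m ≡ arcAt m (just v)
  arcAt-into (just u) v = refl
  arcAt-into nothing  v = refl

  dir-reverse : ∀ {u v} → GridAdj u v → dir o v u ≡ not (dir o u v)
  dir-reverse {u} {v} adj with dir o u v in e
  ... | true  = one-way o u v adj e
  ... | false = some-way o u v adj e

  inFromLeft : ∀ {i j} (i<p : i < p) (j<q : j < q) →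
    ∑V (λ u → 𝟙 (dir o u (vertex i<p j<q) ∧ leftOf i j u)) ≡ 𝟙 (inPrev (λ x → right x j) i)
  inFromLeft {zero}   i<p j<q = ∑V-zero _ (λ u → 𝟙-∧-false (dir o u _) λ ())
  inFromLeft {suc i} {j} i<p j<q = trans (∑V-isAt i j (λ u → dir o u (vertex i<p j<q)))
    (cong 𝟙 (trans (arcAt-into (vertexAt i j) _) (cong (arcAt (vertexAt i j)) (sym (vertexAt-just i<p j<q)))))

  inFromBelow : ∀ {i j} (i<p : i < p) (j<q : j < q) →
    ∑V (λ u → 𝟙 (dir o u (vertex i<p j<q) ∧ belowOf i j u)) ≡ 𝟙 (inPrev (up i) j)
  inFromBelow {i} {zero} i<p j<q =
    ∑V-zero _ (λ u → 𝟙-∧-false (dir o u (vertex i<p j<q)) (subst T (∧-zeroʳ (toℕ (proj₁ u) ≡ᵇ i))))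
  inFromBelow {i} {suc j} i<p j<q = trans (∑V-isAt i j (λ u → dir o u (vertex i<p j<q)))
    (cong 𝟙 (trans (arcAt-into (vertexAt i j) _) (cong (arcAt (vertexAt i j)) (sym (vertexAt-just i<p j<q)))))

  inFromRight : ∀ {i j} (i<p : i < p) (j<q : j < q) →
    ∑V (λ u → 𝟙 (dir o u (vertex i<p j<q) ∧ isAt (suc i) j u)) ≡ 𝟙 (inNext p (λ x → right x j) i)
  inFromRight {i} {j} i<p j<q = trans (∑V-isAt (suc i) j (λ u → dir o u (vertex i<p j<q)))
    (cong 𝟙 (trans (arcAt-into (vertexAt (suc i) j) _) (arc (suc i ℕ.<? p))))
    where
    arc : Dec (suc i < p) → arcAt (vertexAt (suc i) j) (just (vertex i<p j<q)) ≡ inNext p (λ x → right x j) i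
    arc (yes i+1<p) rewrite vertexAt-just i+1<p j<q | vertexAt-just i<p j<q | <ᵇ-true i+1<p =
      dir-reverse (adjacent-right i<p i+1<p j<q)
    arc (no i+1≮p) = trans (cong (λ m → arcAt m (just (vertex i<p j<q))) (vertexAt-outˡ i+1≮p))
                           (cong (_∧ not (right i j)) (sym (<ᵇ-false i+1≮p)))

  inFromAbove : ∀ {i j} (i<p : i < p) (j<q : j < q) →
    ∑V (λ u → 𝟙 (dir o u (vertex i<p j<q) ∧ isAt i (suc j) u)) ≡ 𝟙 (inNext q (up i) j)
  inFromAbove {i} {j} i<p j<q = trans (∑V-isAt i (suc j) (λ u → dir o u (vertex i<p j<q)))
    (cong 𝟙 (trans (arcAt-into (vertexAt i (suc j)) _) (arc (suc j ℕ.<? q))))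
    where
    arc : Dec (suc j < q) → arcAt (vertexAt i (suc j)) (just (vertex i<p j<q)) ≡ inNext q (up i) j
    arc (yes j+1<q) rewrite vertexAt-just i<p j+1<q | vertexAt-just i<p j<q | <ᵇ-true j+1<q =
      dir-reverse (adjacent-up i<p j<q j+1<q)
    arc (no j+1≮q) = trans (cong (λ m → arcAt m (just (vertex i<p j<q))) (vertexAt-outʳ j+1≮q))
                           (cong (_∧ not (up i j)) (sym (<ᵇ-false j+1≮q)))

  indeg-neighbours : ∀ {i j} (i<p : i < p) (j<q : j < q) →
    indeg o (vertex i<p j<q) ≡ 𝟙 (inPrev (λ x → right x j) i) ℕ.+ 𝟙 (inNext p (λ x → right x j) i)
                               ℕ.+ 𝟙 (inPrev (up i) j) ℕ.+ 𝟙 (inNext q (up i) j)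
  indeg-neighbours {i} {j} i<p j<q = begin
    ∑V (λ u → 𝟙 (into u))                                   ≡⟨ ∑V-cong split ⟩
    ∑V (λ u → fromL u ℕ.+ fromR u ℕ.+ fromD u ℕ.+ fromU u)
      ≡⟨ trans (∑V-+ _ fromU) (cong (ℕ._+ ∑V fromU)
               (trans (∑V-+ _ fromD) (cong (ℕ._+ ∑V fromD) (∑V-+ fromL fromR)))) ⟩
    ∑V fromL ℕ.+ ∑V fromR ℕ.+ ∑V fromD ℕ.+ ∑V fromU
      ≡⟨ cong₂ ℕ._+_ (cong₂ ℕ._+_ (cong₂ ℕ._+_ (inFromLeft i<p j<q) (inFromRight i<p j<q))
                                  (inFromBelow i<p j<q))
                     (inFromAbove i<p j<q) ⟩
    _ ∎
    where
    open ≡-Reasoning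
    w : Vertex p q
    w = vertex i<p j<q
    into : Vertex p q → Bool
    into u = dir o u w
    fromL fromR fromD fromU : Vertex p q → ℕ
    fromL u = 𝟙 (into u ∧ leftOf i j u)
    fromR u = 𝟙 (into u ∧ isAt (suc i) j u)
    fromD u = 𝟙 (into u ∧ belowOf i j u)
    fromU u = 𝟙 (into u ∧ isAt i (suc j) u)
    split : ∀ u → 𝟙 (into u) ≡ fromL u ℕ.+ fromR u ℕ.+ fromD u ℕ.+ fromU u
    split u with dir o u w in e
    ... | false = refl
    ... | true  = sym (neighbour-position i<p j<q u (dir-edge o u w e))

  TOdd-RowParity : ∀ {S} → TOdd S o → ∀ j → j < q →
    RowParity p (λ i → right i j) (λ i → inPrev (up i) j xor inNext q (up i) j) (λ i → labelAt S i j)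
  TOdd-RowParity {S} odd j j<q i i<p = trans (cong (maybe′ S false) (vertexAt-just i<p j<q))
    (⇔-𝟙 (subst (λ n → (n ≡ 1) ⇔ (S w ≡ true))
                (trans (cong (_% 2) (indeg-neighbours i<p j<q)) (𝟙-parity L R D U)) (odd w)))
    where
    w : Vertex p q
    w = vertex i<p j<q
    L R D U : Bool
    L = inPrev (λ x → right x j) i
    R = inNext p (λ x → right x j) i
    D = inPrev (up i) j
    U = inNext q (up i) j

  right-vertex : ∀ {i j} (i+1<p : suc i < p) (j<q : j < q) →
                 right i j ≡ dir o (vertex (ℕ.<⇒≤ i+1<p) j<q) (vertex i+1<p j<q)
  right-vertex i+1<p j<q rewrite vertexAt-just (ℕ.<⇒≤ i+1<p) j<q | vertexAt-just i+1<p j<q = refl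

  up-vertex : ∀ {i j} (i<p : i < p) (j+1<q : suc j < q) →
              up i j ≡ dir o (vertex i<p (ℕ.<⇒≤ j+1<q)) (vertex i<p j+1<q)
  up-vertex i<p j+1<q rewrite vertexAt-just i<p (ℕ.<⇒≤ j+1<q) | vertexAt-just i<p j+1<q = refl

  acyclic-squares : Acyclic o → ∀ i j → suc i < p → suc j < q →
                    T (acyclicSquare (right i j) (right i (suc j)) (up i j) (up (suc i) j))
  acyclic-squares acyclic i j i+1<p j+1<q
    rewrite right-vertex i+1<p (ℕ.<⇒≤ j+1<q) | right-vertex i+1<p j+1<q
          | up-vertex (ℕ.<⇒≤ i+1<p) j+1<q | up-vertex i+1<p j+1<q =
    acyclicSquare-intro (dir o u₀₀ u₁₀) (dir o u₀₁ u₁₁) (dir o u₀₀ u₀₁) (dir o u₁₀ u₁₁) ccw cw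
    where
    i<p : i < p
    i<p = ℕ.<⇒≤ i+1<p
    j<q : j < q
    j<q = ℕ.<⇒≤ j+1<q
    u₀₀ u₁₀ u₀₁ u₁₁ : Vertex p q
    u₀₀ = vertex i<p j<q
    u₁₀ = vertex i+1<p j<q
    u₀₁ = vertex i<p j+1<q
    u₁₁ = vertex i+1<p j+1<q
    ccw : ¬ T (counterclockwise (dir o u₀₀ u₁₀) (dir o u₀₁ u₁₁) (dir o u₀₀ u₀₁) (dir o u₁₀ u₁₁))
    ccw h with counterclockwise-sound h
    ... | b , r , t , l = acyclic u₀₀ (b ∷ r ∷ some-way o u₀₁ u₁₁ (adjacent-right i<p i+1<p j+1<q) t
                                         ∷ [ some-way o u₀₀ u₀₁ (adjacent-up i<p j<q j+1<q) l ])
    cw : ¬ T (clockwise (dir o u₀₀ u₁₀) (dir o u₀₁ u₁₁) (dir o u₀₀ u₀₁) (dir o u₁₀ u₁₁))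
    cw h with clockwise-sound h
    ... | b , r , t , l = acyclic u₀₀ (l ∷ t ∷ some-way o u₁₀ u₁₁ (adjacent-up i+1<p j<q j+1<q) r
                                         ∷ [ some-way o u₀₀ u₁₀ (adjacent-right i<p i+1<p j<q) b ])

BadPath⇒IsBadPath : ∀ {P} {t : Fin (double P) → Bool} (t′ : ℕ → Bool) → 0 < P →
                    (∀ {i} (i<2P : i < double P) → t′ i ≡ t (fromℕ< i<2P)) →
                    BadPath (double P) t → IsBadPath P t′
BadPath⇒IsBadPath {suc P} t′ _ t′≡t (_ , _ , first , last , pairs) = record
  { first  = trans (t′≡t first<) (first _ (toℕ-fromℕ< first<))
  ; last   = trans (t′≡t last<) (last _ (toℕ-fromℕ< last<))
  ; paired = λ k k+1<P → let odd< = double-< (ℕ.<⇒≤ k+1<P) ; even< = ℕ.<⇒≤ (double-< k+1<P) in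
      trans (t′≡t odd<) (trans (⇔⇒≡ (pairs (suc k) _ _ (s≤s z≤n)
        (subst (ℕ._≤ double P) (double≡2* (suc k)) (double-mono-≤ (ℕ.≤-pred k+1<P)))
        (trans (toℕ-fromℕ< odd<) (cong (_∸ 1) (double≡2* (suc k))))
        (trans (toℕ-fromℕ< even<) (double≡2* (suc k)))))
      (sym (t′≡t even<)))
  }
  where
  first< : 0 < double (suc P)
  first< = s≤s z≤n
  last< : suc (double P) < double (suc P)
  last< = ℕ.≤-refl

module _ {P Q : ℕ} (S : Vertex (double P) (double Q) → Bool) (0<P : 0 < P) (0<Q : 0 < Q) where

  private
    0<2P : 0 < double P
    0<2P = ℕ.<⇒≤ (double-< 0<P)
    0<2Q : 0 < double Q
    0<2Q = ℕ.<⇒≤ (double-< 0<Q)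

  BadGrid-rows : BadGrid (double P) (double Q) S →
                 ∀ j → j ≡ 0 ⊎ j ≡ double Q ∸ 1 → IsBadPath P (λ i → labelAt S i j)
  BadGrid-rows (_ , _ , rows , _) j boundary =
    BadPath⇒IsBadPath _ 0<P (λ i<2P → cong (maybe′ S false) (vertexAt-just i<2P j<2Q))
      (rows (fromℕ< j<2Q) (Sum.map (trans (toℕ-fromℕ< j<2Q)) (trans (toℕ-fromℕ< j<2Q)) boundary))
    where
    j<2Q : j < double Q
    j<2Q = boundary-< 0<2Q boundary

  BadGrid-columns : BadGrid (double P) (double Q) S →
                    ∀ i → i ≡ 0 ⊎ i ≡ double P ∸ 1 → IsBadPath Q (labelAt S i)
  BadGrid-columns (_ , _ , _ , columns , _) i boundary =
    BadPath⇒IsBadPath _ 0<Q (λ j<2Q → cong (maybe′ S false) (vertexAt-just i<2P j<2Q))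
      (columns (fromℕ< i<2P) (Sum.map (trans (toℕ-fromℕ< i<2P)) (trans (toℕ-fromℕ< i<2P)) boundary))
    where
    i<2P : i < double P
    i<2P = boundary-< 0<2P boundary

  BadGrid-interior : BadGrid (double P) (double Q) S →
                     ∀ i j → 0 < i → suc i < double P → 0 < j → suc j < double Q → labelAt S i j ≡ true
  BadGrid-interior (_ , _ , _ , _ , interior) i j 0<i i+1<2P 0<j j+1<2Q =
    trans (cong (maybe′ S false) (vertexAt-just i<2P j<2Q))
      (interior (fromℕ< i<2P) (fromℕ< j<2Q)
        (subst (1 ℕ.≤_) (sym (toℕ-fromℕ< i<2P)) 0<i)
        (subst (ℕ._≤ double P ∸ 2) (sym (toℕ-fromℕ< i<2P)) (ℕ.∸-monoˡ-≤ 2 i+1<2P))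
        (subst (1 ℕ.≤_) (sym (toℕ-fromℕ< j<2Q)) 0<j)
        (subst (ℕ._≤ double Q ∸ 2) (sym (toℕ-fromℕ< j<2Q)) (ℕ.∸-monoˡ-≤ 2 j+1<2Q)))
    where
    i<2P : i < double P
    i<2P = ℕ.<⇒≤ i+1<2P
    j<2Q : j < double Q
    j<2Q = ℕ.<⇒≤ j+1<2Q

lemma9 : (p q : ℕ) → 0 < p → 0 < q → (T : Vertex p q → Bool) → BadGrid p q T →
    ¬ (Σ (Orientation p q) λ o → Acyclic o × TOdd T o)
lemma9 p q 0<p 0<q S bad@(2∣p , 2∣q , _) (o , acyclic , odd) with halve 2∣p | halve 2∣q
... | P , refl | Q , refl =
  BadGridℕ.impossible P Q right up (labelAt S) (TOdd-RowParity odd) (acyclic-squares acyclic)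
    (BadGrid-rows S 0<P 0<Q bad) (BadGrid-columns S 0<P 0<Q bad) (BadGrid-interior S 0<P 0<Q bad) 0<P 0<Q
  where
  open OrientationView o
  0<P : 0 < P
  0<P = double-pos⁻¹ 0<p
  0<Q : 0 < Q
  0<Q = double-pos⁻¹ 0<q
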